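{- Let $c$ be a positive integer, $\zeta_{2c}$ a primitive $2c$-th root of unity, and for $n\ge0$ let $Q_n=\sum_{m=0}^n\zeta_{2c}^m\binom{n}{m}_q$. For $n\ge0$ define $R_n\in\mathbb{Z}[\zeta_{2c}][q]$ by $$Q_n=R_n\prod_{k\text{ odd}}\Phi_{kc}(q)^{\left\lfloor \frac{n}{2kc}\right\rceil}$$ (product over odd positive integers $k$). Then for every $n\ge2$, $$R_n\prod_{k\text{ odd}}\Phi_{kc}(q)^{\alpha(kc,n)}=(1+\zeta_{2c})R_{n-1}\prod_{k\text{ odd}}\Phi_{kc}(q)^{\beta(kc,n)}-\zeta_{2c}(1-q^{n-1})R_{n-2},$$ where $\alpha(kc,n)=1$ if $n=ikc$ or $n=ikc+1$ for some odd integer $i$ and $\alpha(kc,n)=0$ otherwise, and $\beta(kc,n)=1$ if $n=ikc+1$ for some odd integer $i$ and $\beta(kc,n)=0$ otherwise.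
   Context: $\lfloor x\rceil$ denotes the nonnegative integer closest to $x$, with $\lfloor x\rceil=0$ for $x<1/2$ and $\lfloor N+\tfrac12\rceil=N+1$ for $N\in\mathbb{Z}_{\ge0}$. The paper shows that $Q_n$ is divisible by $\prod_{k\text{ odd}}\Phi_{kc}(q)^{\lfloor n/(2kc)\rceil}$, so $R_n$ is a well-defined polynomial. $\binom{n}{m}_q$ is the $q$-binomial coefficient and $\Phi_N(q)$ the $N$-th cyclotomic polynomial. -}

module Defs where

open import Data.Nat as ℕ using (ℕ; zero; suc; _≡ᵇ_; _%_; _/_; _∸_)
open import Data.Nat.Divisibility using (_∣?_)
open import Data.Integer as ℤ using (ℤ; 0ℤ; 1ℤ; -_)
open import Data.Bool using (Bool; true; false; _∧_; _∨_; if_then_else_) renaming (_≟_ to _≟B_)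
open import Data.List using (List; [];  _∷_; map; filter; foldr; upTo; applyUpTo)
open import Data.Bool.ListAction using (any)
open import Data.Product using (Σ)
open import Relation.Binary.PropositionalEquality using (_≡_)

-- Generic dense polynomial arithmetic on coefficient lists
-- (lowest degree first), over a coefficient type with 0, +, *, negation.

module PolyOps {A : Set} (0# : A) (_+'_ _*'_ : A → A → A) (neg : A → A) where
  add : List A → List A → List A
  add [] ys = ys
  add (x ∷ xs) [] = x ∷ xs
  add (x ∷ xs) (y ∷ ys) = (x +' y) ∷ add xs ys

  scale : A → List A → List A
  scale a = map (a *'_)

  mul : List A → List A → List A
  mul [] ys = []
  mul (x ∷ xs) ys = add (scale x ys) (0# ∷ mul xs ys)

  negP : List A → List A
  negP = map neg

  sub : List A → List A → List A
  sub p r = add p (negP r)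

  coeff : List A → ℕ → A
  coeff [] _ = 0#
  coeff (x ∷ xs) zero = x
  coeff (x ∷ xs) (suc i) = coeff xs i

PZ : Set
PZ = List ℤ

module Z = PolyOps 0ℤ ℤ._+_ ℤ._*_ -_

oneZ : PZ
oneZ = 1ℤ ∷ []

varZ : PZ
varZ = 0ℤ ∷ 1ℤ ∷ []

powZ : PZ → ℕ → PZ
powZ p zero = oneZ
powZ p (suc n) = Z.mul p (powZ p n)

prodZ : List PZ → PZ
prodZ = foldr Z.mul oneZ

-- equality of polynomials: all coefficients agree (trailing zeros ignored)
_≐Z_ : PZ → PZ → Set
p ≐Z r = ∀ i → Z.coeff p i ≡ Z.coeff r i

-- Φ is the family of cyclotomic polynomials: for every N ≥ 1,
--   ∏_{d ∣ N, 1 ≤ d ≤ N} Φ_d(x) = x^N - 1.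
-- (This determines Φ_N uniquely for all N ≥ 1, by induction on N.)
IsCyclotomicFamily : (ℕ → PZ) → Set
IsCyclotomicFamily Φ =
  ∀ N → 1 ℕ.≤ N →
    prodZ (map Φ (filter (_∣? N) (applyUpTo suc N))) ≐Z Z.sub (powZ varZ N) oneZ

-- ℤ[z][q] : polynomials in q whose coefficients are polynomials in z.
-- ℤ[ζ_{2c}][q] is modelled as ℤ[z][q] modulo the ideal (Φ_{2c}(z)).

PZQ : Set
PZQ = List PZ

module ZQ = PolyOps [] Z.add Z.mul Z.negP

coeff2 : PZQ → ℕ → ℕ → ℤ
coeff2 P i j = Z.coeff (ZQ.coeff P i) j

oneQ : PZQ
oneQ = oneZ ∷ []

qQ : PZQ
qQ = [] ∷ oneZ ∷ []

zetaQ : PZQ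
zetaQ = varZ ∷ []

constQ : PZ → PZQ
constQ p = p ∷ []

inQ : PZ → PZQ
inQ = map (λ a → a ∷ [])

powQ : PZQ → ℕ → PZQ
powQ p zero = oneQ
powQ p (suc n) = ZQ.mul p (powQ p n)

prodQ : List PZQ → PZQ
prodQ = foldr ZQ.mul oneQ

sumQ : List PZQ → PZQ
sumQ = foldr ZQ.add []

-- equality in ℤ[ζ_{2c}][q]:  P ≡ P'  modulo Φ_{2c}(z),
-- i.e. P - P' = Φ_{2c}(z) · H for some H ∈ ℤ[z][q].
Eqζ : (ℕ → PZ) → ℕ → PZQ → PZQ → Set
Eqζ Φ c P P' =
  Σ PZQ λ H → ∀ i j →
    coeff2 (ZQ.sub P P') i j ≡ coeff2 (ZQ.mul (constQ (Φ (2 ℕ.* c))) H) i j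

qbinom : ℕ → ℕ → PZQ
qbinom n zero = oneQ
qbinom zero (suc m) = []
qbinom (suc n) (suc m) = ZQ.add (qbinom n m) (ZQ.mul (powQ qQ (suc m)) (qbinom n (suc m)))

Qn : ℕ → PZQ
Qn n = sumQ (map (λ m → ZQ.mul (powQ zetaQ m) (qbinom n m)) (upTo (suc n)))

-- ⌊ n / (2d) ⌉  (nearest integer, halves rounded up) = ⌊ (n + d) / (2d) ⌋
roundHalf : ℕ → ℕ → ℕ
roundHalf n zero = 0
roundHalf n (suc d) = (n ℕ.+ suc d) / (suc d ℕ.+ suc d)

isOdd : ℕ → Bool
isOdd i = i % 2 ≡ᵇ 1

-- oddMult d n = true iff n = i·d for some odd integer i.
-- (Only used with d ≥ 1 and n ≥ 1, where such i is necessarily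
--  positive and ≤ n, so a bounded search over 0..n is exhaustive.)
oddMult : ℕ → ℕ → Bool
oddMult d n = any (λ i → isOdd i ∧ (i ℕ.* d ≡ᵇ n)) (upTo (suc n))

α : ℕ → ℕ → ℕ
α d n = if oddMult d n ∨ oddMult d (n ∸ 1) then 1 else 0

β : ℕ → ℕ → ℕ
β d n = if oddMult d (n ∸ 1) then 1 else 0

-- ∏_{k odd, 1 ≤ k ≤ N} Φ_{kc}(q)^{e k}.
-- (For all uses below, factors with k > N have exponent 0.)
oddProd : (ℕ → PZ) → ℕ → ℕ → (ℕ → ℕ) → PZQ
oddProd Φ c N e =
  prodQ (map (λ k → powQ (inQ (Φ (k ℕ.* c))) (e k)) (filter (λ k → isOdd k ≟B true) (applyUpTo suc N)))

{-# OPTIONS --safe #-}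

-- Work in ℤ[ζ][q] = (ℤ[z]/(Φ_{2c}(z)))[q]. Splitting [n+1,m+1]_q by the two q-Pascal rules gives
-- Q_{n+1} = Q_n + ζ F_n and F_{n+1} = ζ F_n + q^{n+1} Q_n for F_n = Σ_m q^{n-m} ζ^m [n,m]_q, and
-- eliminating F yields Q_{n+2} = (1 + ζ) Q_{n+1} - ζ (1 - q^{n+1}) Q_n.
-- The rounded quotient ⌊n/(2d)⌉ = ⌊(n+d)/(2d)⌋ grows at n+1 exactly when 2d ∣ n+1+d, i.e. when n+1 is
-- an odd multiple of d, and n, n+1 are never both odd multiples of d. Hence the exponents of Φ_{kc}
-- prescribed for Q_{n+2} and Q_{n+1} exceed those for Q_n by α(kc,n+2) and β(kc,n+2), and substituting
-- Q_j = R_j P_j into the recurrence gives the claimed identity multiplied by the cyclotomic part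
-- E = ∏_k Φ_{kc}(q)^{⌊n/(2kc)⌉} of Q_n. Each Φ_N(q) divides q^N - 1, which is a non-zero-divisor in any
-- polynomial ring (a polynomial equal to its shift by N vanishes), so E can be cancelled.

module Submission where

open import Defs
open import Algebra.Bundles using (CommutativeRing; CommutativeSemiring)
open import Algebra.Structures using (IsCommutativeRing)
open import Algebra.Morphism.Structures using (IsRingHomomorphism)
import Algebra.Morphism.Construct.Composition as Composition
open import Data.Bool using (true; false)
import Data.Bool
import Data.Integer.Properties as ℤ
import Data.Integer.Tactic.RingSolver as ℤ-Solver
open import Data.List using (List; []; _∷_; _∷ʳ_; map; filter; applyUpTo; replicate; _++_)
open import Data.List.Membership.Propositional using (_∈_)
open import Data.List.Membership.Propositional.Properties using (∈-filter⁺; ∈-applyUpTo⁺)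
open import Data.List.Relation.Unary.All using (All; []; _∷_)
import Data.List.Relation.Unary.All.Properties as All
open import Data.List.Relation.Unary.Any using (here; there)
open import Data.Maybe using (Maybe; just; nothing)
open import Data.Nat as ℕ using (ℕ; zero; suc; _<_; _≤_; s≤s; z≤n)
import Data.Nat.Properties as ℕ
open import Data.Nat.Divisibility using (_∣?_; ∣-refl)
open import Data.Nat.Induction using (<-rec)
open import Data.Product using (Σ; _,_)
open import Function using (_∘_)
open import Level using (0ℓ; _⊔_)
open import Relation.Binary.PropositionalEquality as ≡ using (_≡_)
open import Relation.Binary.Structures using (IsEquivalence)
open import Relation.Nullary using (yes; no)
open import Tactic.RingSolver using (solve-∀)
open import Tactic.RingSolver.Core.AlmostCommutativeRing using (AlmostCommutativeRing; fromCommutativeRing)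

module NonZeroDivisors {c ℓ} (R : CommutativeRing c ℓ) where
  open CommutativeRing R
  open import Relation.Binary.Reasoning.Setoid setoid

  NonZeroDivisor : Carrier → Set (c ⊔ ℓ)
  NonZeroDivisor a = ∀ x → x * a ≈ 0# → x ≈ 0#

  nonZeroDivisor-1 : NonZeroDivisor 1#
  nonZeroDivisor-1 x x1≈0 = trans (sym (*-identityʳ x)) x1≈0

  nonZeroDivisor-* : ∀ {a b} → NonZeroDivisor a → NonZeroDivisor b → NonZeroDivisor (a * b)
  nonZeroDivisor-* {a} {b} nzd-a nzd-b x xab≈0 =
    nzd-a x (nzd-b (x * a) (trans (*-assoc x a b) xab≈0))

  nonZeroDivisor-∣ : ∀ {a b} r → a * r ≈ b → NonZeroDivisor b → NonZeroDivisor a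
  nonZeroDivisor-∣ {a} {b} r ar≈b nzd-b x xa≈0 = nzd-b x (begin
    x * b        ≈⟨ *-congˡ ar≈b ⟨
    x * (a * r)  ≈⟨ *-assoc x a r ⟨
    x * a * r    ≈⟨ *-congʳ xa≈0 ⟩
    0# * r       ≈⟨ zeroˡ r ⟩
    0#           ∎)

module Polynomial {ℓ} (R : CommutativeRing 0ℓ ℓ) where
  open CommutativeRing R hiding (zero; isCommutativeRing)
  open import Algebra.Properties.Group +-group using (ε⁻¹≈ε)
  open import Relation.Binary.Reasoning.Setoid setoid
  open PolyOps 0# _+_ _*_ -_ public

  Poly : Set
  Poly = List Carrier

  infix 4 _≋_
  record _≋_ (p r : Poly) : Set ℓ where
    constructor mk≋
    field coeff-≈ : ∀ i → coeff p i ≈ coeff r i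
  open _≋_ public

  ≋-refl : ∀ {p} → p ≋ p
  ≋-refl = mk≋ λ i → refl

  ≋-sym : ∀ {p r} → p ≋ r → r ≋ p
  ≋-sym p≋r = mk≋ λ i → sym (coeff-≈ p≋r i)

  ≋-trans : ∀ {p r s} → p ≋ r → r ≋ s → p ≋ s
  ≋-trans p≋r r≋s = mk≋ λ i → trans (coeff-≈ p≋r i) (coeff-≈ r≋s i)

  ≋-isEquivalence : IsEquivalence _≋_
  ≋-isEquivalence = record { refl = ≋-refl ; sym = ≋-sym ; trans = ≋-trans }

  ∷-cong : ∀ {a b p r} → a ≈ b → p ≋ r → a ∷ p ≋ b ∷ r
  ∷-cong a≈b p≋r = mk≋ λ where
    zero → a≈b
    (suc i) → coeff-≈ p≋r i

  []≋0∷[] : [] ≋ 0# ∷ []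
  []≋0∷[] = mk≋ λ where
    zero → refl
    (suc i) → refl

  coeff-add : ∀ p r i → coeff (add p r) i ≈ coeff p i + coeff r i
  coeff-add [] r i = sym (+-identityˡ _)
  coeff-add (a ∷ p) [] zero = sym (+-identityʳ a)
  coeff-add (a ∷ p) [] (suc i) = sym (+-identityʳ _)
  coeff-add (a ∷ p) (b ∷ r) zero = refl
  coeff-add (a ∷ p) (b ∷ r) (suc i) = coeff-add p r i

  coeff-scale : ∀ a p i → coeff (scale a p) i ≈ a * coeff p i
  coeff-scale a [] i = sym (zeroʳ a)
  coeff-scale a (b ∷ p) zero = refl
  coeff-scale a (b ∷ p) (suc i) = coeff-scale a p i

  coeff-negP : ∀ p i → coeff (negP p) i ≈ - coeff p i
  coeff-negP [] i = sym ε⁻¹≈ε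
  coeff-negP (a ∷ p) zero = refl
  coeff-negP (a ∷ p) (suc i) = coeff-negP p i

  coeff-mul-zero : ∀ a p r → coeff (mul (a ∷ p) r) zero ≈ a * coeff r zero
  coeff-mul-zero a p r = trans (coeff-add (scale a r) (0# ∷ mul p r) zero)
    (trans (+-identityʳ _) (coeff-scale a r zero))

  coeff-mul-suc : ∀ a p r i → coeff (mul (a ∷ p) r) (suc i) ≈ a * coeff r (suc i) + coeff (mul p r) i
  coeff-mul-suc a p r i = trans (coeff-add (scale a r) (0# ∷ mul p r) (suc i)) (+-congʳ (coeff-scale a r (suc i)))

  add-cong : ∀ {p p′ r r′} → p ≋ p′ → r ≋ r′ → add p r ≋ add p′ r′
  add-cong {p} {p′} {r} {r′} p≋p′ r≋r′ = mk≋ λ i → begin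
    coeff (add p r) i          ≈⟨ coeff-add p r i ⟩
    coeff p i + coeff r i      ≈⟨ +-cong (coeff-≈ p≋p′ i) (coeff-≈ r≋r′ i) ⟩
    coeff p′ i + coeff r′ i    ≈⟨ coeff-add p′ r′ i ⟨
    coeff (add p′ r′) i        ∎

  scale-cong : ∀ {a b p r} → a ≈ b → p ≋ r → scale a p ≋ scale b r
  scale-cong {a} {b} {p} {r} a≈b p≋r = mk≋ λ i →
    trans (coeff-scale a p i) (trans (*-cong a≈b (coeff-≈ p≋r i)) (sym (coeff-scale b r i)))

  negP-cong : ∀ {p r} → p ≋ r → negP p ≋ negP r
  negP-cong {p} {r} p≋r = mk≋ λ i →
    trans (coeff-negP p i) (trans (-‿cong (coeff-≈ p≋r i)) (sym (coeff-negP r i)))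

  add-comm : ∀ p r → add p r ≋ add r p
  add-comm p r = mk≋ λ i → trans (coeff-add p r i) (trans (+-comm _ _) (sym (coeff-add r p i)))

  add-assoc : ∀ p r s → add (add p r) s ≋ add p (add r s)
  add-assoc p r s = mk≋ λ i → begin
    coeff (add (add p r) s) i                ≈⟨ coeff-add (add p r) s i ⟩
    coeff (add p r) i + coeff s i            ≈⟨ +-congʳ (coeff-add p r i) ⟩
    coeff p i + coeff r i + coeff s i        ≈⟨ +-assoc _ _ _ ⟩
    coeff p i + (coeff r i + coeff s i)      ≈⟨ +-congˡ (coeff-add r s i) ⟨
    coeff p i + coeff (add r s) i            ≈⟨ coeff-add p (add r s) i ⟨
    coeff (add p (add r s)) i                ∎

  add-identityˡ : ∀ p → add [] p ≋ p
  add-identityˡ p = ≋-refl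

  add-identityʳ : ∀ p → add p [] ≋ p
  add-identityʳ p = ≋-trans (add-comm p []) (add-identityˡ p)

  add-inverseˡ : ∀ p → add (negP p) p ≋ []
  add-inverseˡ p = mk≋ λ i →
    trans (coeff-add (negP p) p i) (trans (+-congʳ (coeff-negP p i)) (-‿inverseˡ _))

  add-inverseʳ : ∀ p → add p (negP p) ≋ []
  add-inverseʳ p = ≋-trans (add-comm p (negP p)) (add-inverseˡ p)

  mul-zeroʳ : ∀ p → mul p [] ≋ []
  mul-zeroʳ [] = ≋-refl
  mul-zeroʳ (a ∷ p) = ≋-trans (∷-cong refl (mul-zeroʳ p)) (≋-sym []≋0∷[])

  open import Algebra.Properties.CommutativeSemigroup +-commutativeSemigroup
    using (interchange; x∙yz≈y∙xz)

  mul-congʳ : ∀ p {r r′} → r ≋ r′ → mul p r ≋ mul p r′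
  mul-congʳ [] r≋r′ = ≋-refl
  mul-congʳ (a ∷ p) r≋r′ = add-cong (scale-cong refl r≋r′) (∷-cong refl (mul-congʳ p r≋r′))

  mul-∷ʳ : ∀ p b r → mul p (b ∷ r) ≋ add (scale b p) (0# ∷ mul p r)
  mul-∷ʳ [] b r = mk≋ λ where
    zero → refl
    (suc i) → refl
  mul-∷ʳ (a ∷ p) b r = mk≋ λ where
    zero → trans (coeff-mul-zero a p (b ∷ r)) (trans (*-comm a b) (sym (+-identityʳ _)))
    (suc i) → begin
      coeff (mul (a ∷ p) (b ∷ r)) (suc i)
        ≈⟨ coeff-mul-suc a p (b ∷ r) i ⟩
      a * coeff r i + coeff (mul p (b ∷ r)) i
        ≈⟨ +-congˡ (trans (coeff-≈ (mul-∷ʳ p b r) i) (coeff-add (scale b p) (0# ∷ mul p r) i)) ⟩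
      a * coeff r i + (coeff (scale b p) i + coeff (0# ∷ mul p r) i)
        ≈⟨ x∙yz≈y∙xz _ _ _ ⟩
      coeff (scale b p) i + (a * coeff r i + coeff (0# ∷ mul p r) i)
        ≈⟨ +-congˡ (trans (coeff-add (scale a r) (0# ∷ mul p r) i) (+-congʳ (coeff-scale a r i))) ⟨
      coeff (scale b p) i + coeff (mul (a ∷ p) r) i
        ≈⟨ coeff-add (scale b p) (mul (a ∷ p) r) i ⟨
      coeff (add (scale b p) (mul (a ∷ p) r)) i
        ∎

  mul-comm : ∀ p r → mul p r ≋ mul r p
  mul-comm [] r = ≋-sym (mul-zeroʳ r)
  mul-comm (a ∷ p) r = ≋-trans (add-cong ≋-refl (∷-cong refl (mul-comm p r))) (≋-sym (mul-∷ʳ r a p))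

  mul-cong : ∀ {p p′ r r′} → p ≋ p′ → r ≋ r′ → mul p r ≋ mul p′ r′
  mul-cong {p} {p′} {r} {r′} p≋p′ r≋r′ =
    ≋-trans (mul-comm p r) (≋-trans (mul-congʳ r p≋p′) (≋-trans (mul-comm r p′) (mul-congʳ p′ r≋r′)))

  mul-distribʳ : ∀ s p r → mul (add p r) s ≋ add (mul p s) (mul r s)
  mul-distribʳ s [] r = ≋-refl
  mul-distribʳ s (a ∷ p) [] = ≋-sym (add-identityʳ (mul (a ∷ p) s))
  mul-distribʳ s (a ∷ p) (b ∷ r) = mk≋ λ where
    zero → begin
      coeff (mul ((a + b) ∷ add p r) s) zero
        ≈⟨ coeff-mul-zero (a + b) (add p r) s ⟩
      (a + b) * coeff s zero
        ≈⟨ distribʳ _ a b ⟩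
      a * coeff s zero + b * coeff s zero
        ≈⟨ +-cong (coeff-mul-zero a p s) (coeff-mul-zero b r s) ⟨
      coeff (mul (a ∷ p) s) zero + coeff (mul (b ∷ r) s) zero
        ≈⟨ coeff-add (mul (a ∷ p) s) (mul (b ∷ r) s) zero ⟨
      coeff (add (mul (a ∷ p) s) (mul (b ∷ r) s)) zero
        ∎
    (suc i) → begin
      coeff (mul ((a + b) ∷ add p r) s) (suc i)
        ≈⟨ coeff-mul-suc (a + b) (add p r) s i ⟩
      (a + b) * coeff s (suc i) + coeff (mul (add p r) s) i
        ≈⟨ +-cong (distribʳ _ a b) (trans (coeff-≈ (mul-distribʳ s p r) i) (coeff-add (mul p s) (mul r s) i)) ⟩
      (a * coeff s (suc i) + b * coeff s (suc i)) + (coeff (mul p s) i + coeff (mul r s) i)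
        ≈⟨ interchange _ _ _ _ ⟩
      (a * coeff s (suc i) + coeff (mul p s) i) + (b * coeff s (suc i) + coeff (mul r s) i)
        ≈⟨ +-cong (coeff-mul-suc a p s i) (coeff-mul-suc b r s i) ⟨
      coeff (mul (a ∷ p) s) (suc i) + coeff (mul (b ∷ r) s) (suc i)
        ≈⟨ coeff-add (mul (a ∷ p) s) (mul (b ∷ r) s) (suc i) ⟨
      coeff (add (mul (a ∷ p) s) (mul (b ∷ r) s)) (suc i)
        ∎

  mul-distribˡ : ∀ s p r → mul s (add p r) ≋ add (mul s p) (mul s r)
  mul-distribˡ s p r =
    ≋-trans (mul-comm s (add p r)) (≋-trans (mul-distribʳ s p r) (add-cong (mul-comm p s) (mul-comm r s)))

  mul-scaleˡ : ∀ a p r → mul (scale a p) r ≋ scale a (mul p r)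
  mul-scaleˡ a [] r = ≋-refl
  mul-scaleˡ a (b ∷ p) r = mk≋ λ where
    zero → begin
      coeff (mul ((a * b) ∷ scale a p) r) zero  ≈⟨ coeff-mul-zero (a * b) (scale a p) r ⟩
      a * b * coeff r zero                      ≈⟨ *-assoc a b _ ⟩
      a * (b * coeff r zero)                    ≈⟨ *-congˡ (coeff-mul-zero b p r) ⟨
      a * coeff (mul (b ∷ p) r) zero            ≈⟨ coeff-scale a (mul (b ∷ p) r) zero ⟨
      coeff (scale a (mul (b ∷ p) r)) zero      ∎
    (suc i) → begin
      coeff (mul ((a * b) ∷ scale a p) r) (suc i)
        ≈⟨ coeff-mul-suc (a * b) (scale a p) r i ⟩
      a * b * coeff r (suc i) + coeff (mul (scale a p) r) i
        ≈⟨ +-cong (*-assoc a b _) (trans (coeff-≈ (mul-scaleˡ a p r) i) (coeff-scale a (mul p r) i)) ⟩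
      a * (b * coeff r (suc i)) + a * coeff (mul p r) i
        ≈⟨ distribˡ a _ _ ⟨
      a * (b * coeff r (suc i) + coeff (mul p r) i)
        ≈⟨ *-congˡ (coeff-mul-suc b p r i) ⟨
      a * coeff (mul (b ∷ p) r) (suc i)
        ≈⟨ coeff-scale a (mul (b ∷ p) r) (suc i) ⟨
      coeff (scale a (mul (b ∷ p) r)) (suc i)
        ∎

  mul-0∷ˡ : ∀ p r → mul (0# ∷ p) r ≋ 0# ∷ mul p r
  mul-0∷ˡ p r = mk≋ λ where
    zero → trans (coeff-mul-zero 0# p r) (zeroˡ _)
    (suc i) → trans (coeff-mul-suc 0# p r i) (trans (+-congʳ (zeroˡ _)) (+-identityˡ _))

  mul-assoc : ∀ p r s → mul (mul p r) s ≋ mul p (mul r s)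
  mul-assoc [] r s = ≋-refl
  mul-assoc (a ∷ p) r s = ≋-trans (mul-distribʳ s (scale a r) (0# ∷ mul p r))
    (add-cong (mul-scaleˡ a r s) (≋-trans (mul-0∷ˡ (mul p r) s) (∷-cong refl (mul-assoc p r s))))

  one : Poly
  one = 1# ∷ []

  mul-identityˡ : ∀ p → mul one p ≋ p
  mul-identityˡ p = mk≋ λ i → begin
    coeff (mul one p) i                          ≈⟨ coeff-add (scale 1# p) (0# ∷ []) i ⟩
    coeff (scale 1# p) i + coeff (0# ∷ []) i     ≈⟨ +-cong (coeff-scale 1# p i) (sym (coeff-≈ []≋0∷[] i)) ⟩
    1# * coeff p i + 0#                          ≈⟨ +-identityʳ _ ⟩
    1# * coeff p i                               ≈⟨ *-identityˡ _ ⟩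
    coeff p i                                    ∎

  mul-identityʳ : ∀ p → mul p one ≋ p
  mul-identityʳ p = ≋-trans (mul-comm p one) (mul-identityˡ p)

  isCommutativeRing : IsCommutativeRing _≋_ add mul negP [] one
  isCommutativeRing = record
    { isRing = record
      { +-isAbelianGroup = record
        { isGroup = record
          { isMonoid = record
            { isSemigroup = record
              { isMagma = record { isEquivalence = ≋-isEquivalence ; ∙-cong = add-cong }
              ; assoc = add-assoc }
            ; identity = add-identityˡ , add-identityʳ }
          ; inverse = add-inverseˡ , add-inverseʳ
          ; ⁻¹-cong = negP-cong }
        ; comm = add-comm }
      ; *-cong = mul-cong
      ; *-assoc = mul-assoc
      ; *-identity = mul-identityˡ , mul-identityʳ
      ; distrib = mul-distribˡ , mul-distribʳ }
    ; *-comm = mul-comm }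

  commutativeRing : CommutativeRing 0ℓ ℓ
  commutativeRing = record { isCommutativeRing = isCommutativeRing }

  zero? : (∀ a → Maybe (0# ≈ a)) → ∀ p → Maybe ([] ≋ p)
  zero? 0≟ [] = just ≋-refl
  zero? 0≟ (a ∷ p) with 0≟ a | zero? 0≟ p
  ... | just 0≈a | just []≋p = just (≋-trans []≋0∷[] (∷-cong 0≈a []≋p))
  ... | _        | _         = nothing

  coeff-sub : ∀ p r i → coeff (sub p r) i ≈ coeff p i - coeff r i
  coeff-sub p r i = trans (coeff-add p (negP r) i) (+-congˡ (coeff-negP r i))

  mul-constantˡ : ∀ a p → mul (a ∷ []) p ≋ scale a p
  mul-constantˡ a p = ≋-trans (add-cong ≋-refl (≋-sym []≋0∷[])) (add-identityʳ (scale a p))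

  coefficients-multiple⇒scale : ∀ a D → (∀ i → Σ Carrier λ h → coeff D i ≈ a * h) →
                                Σ Poly λ H → D ≋ scale a H
  coefficients-multiple⇒scale a [] multiple = [] , ≋-refl
  coefficients-multiple⇒scale a (d ∷ D) multiple
    with multiple zero | coefficients-multiple⇒scale a D (λ i → multiple (suc i))
  ... | h , d≈ah | H , D≋aH = h ∷ H , ∷-cong d≈ah D≋aH

  constant-isRingHomomorphism : IsRingHomomorphism rawRing (CommutativeRing.rawRing commutativeRing) (_∷ [])
  constant-isRingHomomorphism = record
    { isSemiringHomomorphism = record
      { isNearSemiringHomomorphism = record
        { +-isMonoidHomomorphism = record
          { isMagmaHomomorphism = record
            { isRelHomomorphism = record { cong = λ a≈b → ∷-cong a≈b ≋-refl }
            ; homo = λ a b → ≋-refl }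
          ; ε-homo = ≋-sym []≋0∷[] }
        ; *-homo = λ a b → ∷-cong (sym (+-identityʳ (a * b))) ≋-refl }
      ; 1#-homo = ≋-refl }
    ; -‿homo = λ a → ≋-refl }

module PolynomialVariable {ℓ} (R : CommutativeRing 0ℓ ℓ) where
  open Polynomial R
  private module R = CommutativeRing R
  open CommutativeRing commutativeRing hiding (zero)
  open import Algebra.Properties.Semiring.Exp semiring using (_^_)
  open import Algebra.Properties.Group +-group using (x∙y⁻¹≈ε⇒x≈y)
  open import Algebra.Properties.Ring ring using (x[y-z]≈xy-xz)
  open import Relation.Binary.Reasoning.Setoid setoid
  open NonZeroDivisors commutativeRing

  X : Poly
  X = R.0# ∷ one

  mul-Xˡ : ∀ p → X * p ≋ R.0# ∷ p
  mul-Xˡ p = trans (mul-0∷ˡ one p) (∷-cong R.refl (*-identityˡ p))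

  *-X^ : ∀ N p → p * X ^ N ≋ replicate N R.0# ++ p
  *-X^ zero p = *-identityʳ p
  *-X^ (suc N) p = begin
    p * (X * X ^ N)   ≈⟨ x∙yz≈y∙xz p X (X ^ N) ⟩
    X * (p * X ^ N)   ≈⟨ *-congˡ {X} (*-X^ N p) ⟩
    X * (replicate N R.0# ++ p)   ≈⟨ mul-Xˡ _ ⟩
    R.0# ∷ replicate N R.0# ++ p    ∎
    where open import Algebra.Properties.CommutativeSemigroup *-commutativeSemigroup using (x∙yz≈y∙xz)

  coeff-shift-< : ∀ N p i → i < N → coeff (replicate N R.0# ++ p) i ≡ R.0#
  coeff-shift-< (suc N) p zero i<N = ≡.refl
  coeff-shift-< (suc N) p (suc i) (s≤s i<N) = coeff-shift-< N p i i<N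

  coeff-shift-+ : ∀ N p j → coeff (replicate N R.0# ++ p) (N ℕ.+ j) ≡ coeff p j
  coeff-shift-+ zero p j = ≡.refl
  coeff-shift-+ (suc N) p j = coeff-shift-+ N p j

  shift-fixed⇒≋0 : ∀ N → 1 ≤ N → ∀ p → replicate N R.0# ++ p ≋ p → p ≋ []
  shift-fixed⇒≋0 N 1≤N p shift≋p = mk≋ (<-rec _ coeff≈0)
    where
    coeff≈0 : ∀ i → (∀ {j} → j < i → coeff p j R.≈ R.0#) → coeff p i R.≈ R.0#
    coeff≈0 i ih with i ℕ.<? N
    ... | yes i<N = R.trans (R.sym (coeff-≈ shift≋p i)) (R.reflexive (coeff-shift-< N p i i<N))
    ... | no i≮N = R.trans (R.sym (coeff-≈ shift≋p i)) (R.trans (R.reflexive coeff-shift≡) (ih j<i))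
      where
      j : ℕ
      j = i ℕ.∸ N
      N+j≡i : N ℕ.+ j ≡ i
      N+j≡i = ℕ.m+[n∸m]≡n (ℕ.≮⇒≥ i≮N)
      coeff-shift≡ : coeff (replicate N R.0# ++ p) i ≡ coeff p j
      coeff-shift≡ = ≡.trans (≡.cong (coeff (replicate N R.0# ++ p)) (≡.sym N+j≡i)) (coeff-shift-+ N p j)
      j<i : j < i
      j<i = ≡.subst (j <_) N+j≡i (ℕ.m<n+m j 1≤N)

  X^-1-nonZeroDivisor : ∀ N → 1 ≤ N → NonZeroDivisor (X ^ N - 1#)
  X^-1-nonZeroDivisor N 1≤N p p[X^N-1]≈0 = shift-fixed⇒≋0 N 1≤N p (x∙y⁻¹≈ε⇒x≈y _ p (begin
    (replicate N R.0# ++ p) - p     ≈⟨ +-cong (*-X^ N p) (-‿cong (*-identityʳ p)) ⟨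
    p * X ^ N - p * 1#              ≈⟨ x[y-z]≈xy-xz p (X ^ N) 1# ⟨
    p * (X ^ N - 1#)                ≈⟨ p[X^N-1]≈0 ⟩
    0#                              ∎))

module PrincipalQuotient {c ℓ} (R : CommutativeRing c ℓ) (φ : CommutativeRing.Carrier R) where
  open CommutativeRing R hiding (isCommutativeRing)
  open import Algebra.Properties.AbelianGroup +-abelianGroup using (⁻¹-anti-homo‿-; ⁻¹-∙-comm)
  open import Algebra.Properties.Ring ring using (-‿distribʳ-*; [y-z]x≈yx-zx)
  open import Algebra.Properties.CommutativeSemigroup +-commutativeSemigroup using (interchange)
  open import Relation.Binary.Reasoning.Setoid setoid

  infix 4 _≈φ_
  _≈φ_ : Carrier → Carrier → Set (c ⊔ ℓ)
  x ≈φ y = Σ Carrier λ h → x - y ≈ φ * h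

  ≈⇒≈φ : ∀ {x y} → x ≈ y → x ≈φ y
  ≈⇒≈φ {x} {y} x≈y = 0# , (begin
    x - y   ≈⟨ +-congʳ x≈y ⟩
    y - y   ≈⟨ -‿inverseʳ y ⟩
    0#      ≈⟨ zeroʳ φ ⟨
    φ * 0#  ∎)

  ≈φ-sym : ∀ {x y} → x ≈φ y → y ≈φ x
  ≈φ-sym {x} {y} (h , x-y≈φh) = - h , (begin
    y - x        ≈⟨ ⁻¹-anti-homo‿- x y ⟨
    - (x - y)    ≈⟨ -‿cong x-y≈φh ⟩
    - (φ * h)    ≈⟨ -‿distribʳ-* φ h ⟩
    φ * - h      ∎)

  ≈φ-trans : ∀ {x y z} → x ≈φ y → y ≈φ z → x ≈φ z
  ≈φ-trans {x} {y} {z} (h , x-y≈φh) (k , y-z≈φk) = h + k , (begin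
    x - z                  ≈⟨ +-congˡ (+-identityˡ (- z)) ⟨
    x + (0# - z)           ≈⟨ +-congˡ (+-congʳ (-‿inverseˡ y)) ⟨
    x + (- y + y - z)      ≈⟨ +-congˡ (+-assoc (- y) y (- z)) ⟩
    x + (- y + (y - z))    ≈⟨ +-assoc x (- y) (y - z) ⟨
    (x - y) + (y - z)      ≈⟨ +-cong x-y≈φh y-z≈φk ⟩
    φ * h + φ * k          ≈⟨ distribˡ φ h k ⟨
    φ * (h + k)            ∎)

  ≈φ-isEquivalence : IsEquivalence _≈φ_
  ≈φ-isEquivalence = record { refl = ≈⇒≈φ refl ; sym = ≈φ-sym ; trans = ≈φ-trans }

  +-congφ : ∀ {x y u v} → x ≈φ y → u ≈φ v → x + u ≈φ y + v
  +-congφ {x} {y} {u} {v} (h , x-y≈φh) (k , u-v≈φk) = h + k , (begin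
    x + u - (y + v)         ≈⟨ +-congˡ (⁻¹-∙-comm y v) ⟨
    x + u + (- y + - v)     ≈⟨ interchange x u (- y) (- v) ⟩
    (x - y) + (u - v)       ≈⟨ +-cong x-y≈φh u-v≈φk ⟩
    φ * h + φ * k           ≈⟨ distribˡ φ h k ⟨
    φ * (h + k)             ∎)

  -‿congφ : ∀ {x y} → x ≈φ y → - x ≈φ - y
  -‿congφ {x} {y} (h , x-y≈φh) = - h , (begin
    - x - - y     ≈⟨ ⁻¹-∙-comm x (- y) ⟩
    - (x - y)     ≈⟨ -‿cong x-y≈φh ⟩
    - (φ * h)     ≈⟨ -‿distribʳ-* φ h ⟩
    φ * - h       ∎)

  *-congʳφ : ∀ {x y} u → x ≈φ y → x * u ≈φ y * u
  *-congʳφ {x} {y} u (h , x-y≈φh) = h * u , (begin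
    x * u - y * u   ≈⟨ [y-z]x≈yx-zx u x y ⟨
    (x - y) * u     ≈⟨ *-congʳ x-y≈φh ⟩
    φ * h * u       ≈⟨ *-assoc φ h u ⟩
    φ * (h * u)     ∎)

  *-congφ : ∀ {x y u v} → x ≈φ y → u ≈φ v → x * u ≈φ y * v
  *-congφ {x} {y} {u} {v} x≈φy u≈φv = ≈φ-trans (*-congʳφ u x≈φy)
    (≈-subst (*-comm u y) (*-comm v y) (*-congʳφ y u≈φv))
    where
    ≈-subst : ∀ {a b a′ b′} → a ≈ a′ → b ≈ b′ → a ≈φ b → a′ ≈φ b′
    ≈-subst a≈a′ b≈b′ a≈φb = ≈φ-trans (≈⇒≈φ (sym a≈a′)) (≈φ-trans a≈φb (≈⇒≈φ b≈b′))

  isCommutativeRing : IsCommutativeRing _≈φ_ _+_ _*_ -_ 0# 1#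
  isCommutativeRing = record
    { isRing = record
      { +-isAbelianGroup = record
        { isGroup = record
          { isMonoid = record
            { isSemigroup = record
              { isMagma = record { isEquivalence = ≈φ-isEquivalence ; ∙-cong = +-congφ }
              ; assoc = λ x y z → ≈⇒≈φ (+-assoc x y z) }
            ; identity = (λ x → ≈⇒≈φ (+-identityˡ x)) , (λ x → ≈⇒≈φ (+-identityʳ x)) }
          ; inverse = (λ x → ≈⇒≈φ (-‿inverseˡ x)) , (λ x → ≈⇒≈φ (-‿inverseʳ x))
          ; ⁻¹-cong = -‿congφ }
        ; comm = λ x y → ≈⇒≈φ (+-comm x y) }
      ; *-cong = *-congφ
      ; *-assoc = λ x y z → ≈⇒≈φ (*-assoc x y z)
      ; *-identity = (λ x → ≈⇒≈φ (*-identityˡ x)) , (λ x → ≈⇒≈φ (*-identityʳ x))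
      ; distrib = (λ x y z → ≈⇒≈φ (distribˡ x y z)) , (λ x y z → ≈⇒≈φ (distribʳ x y z)) }
    ; *-comm = λ x y → ≈⇒≈φ (*-comm x y) }

  quotientRing : CommutativeRing c (c ⊔ ℓ)
  quotientRing = record { isCommutativeRing = isCommutativeRing }

  projection-isRingHomomorphism : IsRingHomomorphism rawRing (CommutativeRing.rawRing quotientRing) (λ x → x)
  projection-isRingHomomorphism = record
    { isSemiringHomomorphism = record
      { isNearSemiringHomomorphism = record
        { +-isMonoidHomomorphism = record
          { isMagmaHomomorphism = record
            { isRelHomomorphism = record { cong = ≈⇒≈φ }
            ; homo = λ x y → ≈⇒≈φ refl }
          ; ε-homo = ≈⇒≈φ refl }
        ; *-homo = λ x y → ≈⇒≈φ refl }
      ; 1#-homo = ≈⇒≈φ refl }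
    ; -‿homo = λ x → ≈⇒≈φ refl }

module PolynomialMap {ℓ₁ ℓ₂} {R : CommutativeRing 0ℓ ℓ₁} {S : CommutativeRing 0ℓ ℓ₂}
  {f : CommutativeRing.Carrier R → CommutativeRing.Carrier S}
  (f-isRingHomomorphism : IsRingHomomorphism (CommutativeRing.rawRing R) (CommutativeRing.rawRing S) f) where
  private
    module R = CommutativeRing R
    module R[X] = Polynomial R
    module S[X] = Polynomial S
  open CommutativeRing S using (_≈_; _+_; _*_; -_; 0#; refl; sym; trans; +-cong; *-cong; -‿cong)
  open IsRingHomomorphism f-isRingHomomorphism
  open import Relation.Binary.Reasoning.Setoid (CommutativeRing.setoid S)

  coeff-map : ∀ p i → S[X].coeff (map f p) i ≈ f (R[X].coeff p i)
  coeff-map [] i = sym 0#-homo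
  coeff-map (a ∷ p) zero = refl
  coeff-map (a ∷ p) (suc i) = coeff-map p i

  map-cong : ∀ {p r} → p R[X].≋ r → map f p S[X].≋ map f r
  map-cong {p} {r} p≋r = S[X].mk≋ λ i →
    trans (coeff-map p i) (trans (⟦⟧-cong (R[X].coeff-≈ p≋r i)) (sym (coeff-map r i)))

  map-add : ∀ p r → map f (R[X].add p r) S[X].≋ S[X].add (map f p) (map f r)
  map-add p r = S[X].mk≋ λ i → begin
    S[X].coeff (map f (R[X].add p r)) i                  ≈⟨ coeff-map (R[X].add p r) i ⟩
    f (R[X].coeff (R[X].add p r) i)                      ≈⟨ ⟦⟧-cong (R[X].coeff-add p r i) ⟩
    f (R[X].coeff p i R.+ R[X].coeff r i)                 ≈⟨ +-homo _ _ ⟩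
    f (R[X].coeff p i) + f (R[X].coeff r i)               ≈⟨ +-cong (coeff-map p i) (coeff-map r i) ⟨
    S[X].coeff (map f p) i + S[X].coeff (map f r) i      ≈⟨ S[X].coeff-add (map f p) (map f r) i ⟨
    S[X].coeff (S[X].add (map f p) (map f r)) i          ∎

  map-scale : ∀ a p → map f (R[X].scale a p) S[X].≋ S[X].scale (f a) (map f p)
  map-scale a p = S[X].mk≋ λ i → begin
    S[X].coeff (map f (R[X].scale a p)) i    ≈⟨ coeff-map (R[X].scale a p) i ⟩
    f (R[X].coeff (R[X].scale a p) i)        ≈⟨ ⟦⟧-cong (R[X].coeff-scale a p i) ⟩
    f (a R.* R[X].coeff p i)                 ≈⟨ *-homo _ _ ⟩
    f a * f (R[X].coeff p i)                 ≈⟨ *-cong refl (coeff-map p i) ⟨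
    f a * S[X].coeff (map f p) i             ≈⟨ S[X].coeff-scale (f a) (map f p) i ⟨
    S[X].coeff (S[X].scale (f a) (map f p)) i ∎

  map-negP : ∀ p → map f (R[X].negP p) S[X].≋ S[X].negP (map f p)
  map-negP p = S[X].mk≋ λ i → begin
    S[X].coeff (map f (R[X].negP p)) i       ≈⟨ coeff-map (R[X].negP p) i ⟩
    f (R[X].coeff (R[X].negP p) i)           ≈⟨ ⟦⟧-cong (R[X].coeff-negP p i) ⟩
    f (R.- R[X].coeff p i)                   ≈⟨ -‿homo _ ⟩
    - f (R[X].coeff p i)                     ≈⟨ -‿cong (coeff-map p i) ⟨
    - S[X].coeff (map f p) i                 ≈⟨ S[X].coeff-negP (map f p) i ⟨
    S[X].coeff (S[X].negP (map f p)) i       ∎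

  map-mul : ∀ p r → map f (R[X].mul p r) S[X].≋ S[X].mul (map f p) (map f r)
  map-mul [] r = S[X].≋-refl
  map-mul (a ∷ p) r = S[X].≋-trans (map-add (R[X].scale a r) (R.0# ∷ R[X].mul p r))
    (S[X].add-cong (map-scale a r) (S[X].∷-cong 0#-homo (map-mul p r)))

  map-X : map f (R.0# ∷ R.1# ∷ []) S[X].≋ 0# ∷ CommutativeRing.1# S ∷ []
  map-X = S[X].∷-cong 0#-homo (S[X].∷-cong 1#-homo S[X].≋-refl)

module RoundHalf where
  open import Data.Bool using (true; false; T; _∧_; if_then_else_)
  open import Data.Bool.Properties using (T-∧)
  open import Data.Bool.ListAction using (any)
  open import Data.Empty using (⊥-elim)
  open import Data.List using (upTo)
  open import Data.List.Membership.Propositional.Properties using (∈-upTo⁺)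
  open import Data.List.Relation.Unary.Any as Any using (satisfied)
  open import Data.List.Relation.Unary.Any.Properties using (any⁺; any⁻)
  open import Data.Nat as ℕ using (ℕ; zero; suc; _+_; _*_; _%_; _/_; _<_; _≤_; s≤s; NonZero)
  open import Data.Nat.Divisibility using (_∣_; _∤_; divides; ∣m+n∣m⇒∣n; ∣1⇒≡1; n∣m*n; >⇒∤)
  open import Data.Nat.DivMod using (m≡m%n+[m/n]*n; m%n<n; m*n/n≡m; m<n⇒m/n≡0; [m+kn]%n≡m%n; +-distrib-/-∣ʳ)
  import Data.Nat.Properties as ℕ
  import Data.Nat.Tactic.RingSolver as ℕ-Solver
  open import Data.Product using (∃-syntax; _×_; _,_)
  open import Data.Sum using (_⊎_; inj₁; inj₂)
  open import Function using (Equivalence)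
  open import Relation.Binary.PropositionalEquality
  open import Relation.Nullary using (¬_; contradiction)

  oddMult⇒odd-multiple : ∀ d n → T (oddMult d n) → ∃[ i ] i % 2 ≡ 1 × i * d ≡ n
  oddMult⇒odd-multiple d n oddMult-d-n
    with i , odd∧i*d≡ᵇn ← satisfied (any⁻ _ (upTo (suc n)) oddMult-d-n)
    with odd , i*d≡ᵇn ← Equivalence.to T-∧ odd∧i*d≡ᵇn
    = i , ℕ.≡ᵇ⇒≡ (i % 2) 1 odd , ℕ.≡ᵇ⇒≡ (i * d) n i*d≡ᵇn

  odd-multiple⇒oddMult : ∀ d n i → .{{NonZero d}} → i % 2 ≡ 1 → i * d ≡ n → T (oddMult d n)
  odd-multiple⇒oddMult d n i odd i*d≡n = any⁺ (λ j → isOdd j ∧ (j * d ℕ.≡ᵇ n)) (Any.map (λ { refl → witness }) (∈-upTo⁺ i<1+n))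
    where
    witness : T (isOdd i ∧ (i * d ℕ.≡ᵇ n))
    witness = Equivalence.from T-∧ (ℕ.≡⇒≡ᵇ (i % 2) 1 odd , ℕ.≡⇒≡ᵇ (i * d) n i*d≡n)
    i<1+n : i < suc n
    i<1+n = s≤s (subst (i ≤_) i*d≡n (ℕ.m≤m*n i d))

  suc-/ : ∀ y D .{{_ : NonZero D}} →
          (D ∣ suc y × suc y / D ≡ suc (y / D)) ⊎ (D ∤ suc y × suc y / D ≡ y / D)
  suc-/ y D with ℕ.m≤n⇒m<n∨m≡n (m%n<n y D)
  ... | inj₂ 1+r≡D = inj₁ (divides (suc k) 1+y≡[1+k]D , trans (cong (_/ D) 1+y≡[1+k]D) (m*n/n≡m (suc k) D))
    where
    k : ℕ
    k = y / D
    1+y≡[1+k]D : suc y ≡ suc k * D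
    1+y≡[1+k]D = trans (cong suc (m≡m%n+[m/n]*n y D)) (cong (_+ k * D) 1+r≡D)
  ... | inj₁ 1+r<D = inj₂ (D∤1+y , 1+y/D≡k)
    where
    r k : ℕ
    r = y % D
    k = y / D
    1+y≡1+r+kD : suc y ≡ suc r + k * D
    1+y≡1+r+kD = cong suc (m≡m%n+[m/n]*n y D)
    D∤1+y : D ∤ suc y
    D∤1+y D∣1+y = >⇒∤ 1+r<D (∣m+n∣m⇒∣n (subst (D ∣_) (trans 1+y≡1+r+kD (ℕ.+-comm (suc r) (k * D))) D∣1+y) (n∣m*n k))
    1+y/D≡k : suc y / D ≡ k
    1+y/D≡k = begin
      suc y / D                  ≡⟨ cong (_/ D) 1+y≡1+r+kD ⟩
      (suc r + k * D) / D        ≡⟨ +-distrib-/-∣ʳ (suc r) (n∣m*n k) ⟩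
      suc r / D + k * D / D      ≡⟨ cong₂ _+_ (m<n⇒m/n≡0 1+r<D) (m*n/n≡m k D) ⟩
      k                          ∎
      where open ≡-Reasoning

  odd-multiple+ : ∀ s d → (1 + s * 2) * d + d ≡ suc s * (d + d)
  odd-multiple+ = ℕ-Solver.solve-∀

  oddMult⇒∣ : ∀ d n → T (oddMult d n) → d + d ∣ n + d
  oddMult⇒∣ d n oddMult-d-n with i , i%2≡1 , i*d≡n ← oddMult⇒odd-multiple d n oddMult-d-n =
    divides (suc (i / 2)) (begin
      n + d                          ≡⟨ cong (_+ d) i*d≡n ⟨
      i * d + d                      ≡⟨ cong (λ m → m * d + d) i≡1+2s ⟩
      (1 + i / 2 * 2) * d + d        ≡⟨ odd-multiple+ (i / 2) d ⟩
      suc (i / 2) * (d + d)          ∎)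
    where
    open ≡-Reasoning
    i≡1+2s : i ≡ 1 + i / 2 * 2
    i≡1+2s = trans (m≡m%n+[m/n]*n i 2) (cong (_+ i / 2 * 2) i%2≡1)

  ∣⇒oddMult : ∀ d n .{{_ : NonZero d}} → d + d ∣ n + d → T (oddMult d n)
  ∣⇒oddMult d n (divides zero n+d≡0) = contradiction (ℕ.m+n≡0⇒n≡0 n n+d≡0) (ℕ.≢-nonZero⁻¹ d)
  ∣⇒oddMult d n (divides (suc s) n+d≡[1+s][d+d]) =
    odd-multiple⇒oddMult d n (1 + s * 2) ([m+kn]%n≡m%n 1 s 2)
      (ℕ.+-cancelʳ-≡ d ((1 + s * 2) * d) n (trans (odd-multiple+ s d) (sym n+d≡[1+s][d+d])))

  roundHalf-suc : ∀ d n → roundHalf (suc n) d ≡ (if oddMult d (suc n) then 1 else 0) + roundHalf n d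
  roundHalf-suc zero n with oddMult zero (suc n) in eq
  ... | false = refl
  ... | true with i , _ , i*0≡1+n ← oddMult⇒odd-multiple zero (suc n) (subst T (sym eq) _) =
    contradiction (trans (sym (ℕ.*-zeroʳ i)) i*0≡1+n) (λ ())
  roundHalf-suc d@(suc _) n with suc-/ (n + d) (d + d) | oddMult d (suc n) in eq
  ... | inj₁ (_ , step) | true = step
  ... | inj₂ (_ , step) | false = step
  ... | inj₁ (D∣1+n+d , _) | false = ⊥-elim (subst T eq (∣⇒oddMult d (suc n) D∣1+n+d))
  ... | inj₂ (D∤1+n+d , _) | true = contradiction (oddMult⇒∣ d (suc n) (subst T (sym eq) _)) D∤1+n+d

  oddMult-not-consecutive : ∀ d n → T (oddMult d n) → ¬ T (oddMult d (suc n))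
  oddMult-not-consecutive d n oddMult-n oddMult-1+n = d+d≢1 d (∣1⇒≡1 D∣1)
    where
    D∣1 : d + d ∣ 1
    D∣1 = ∣m+n∣m⇒∣n (subst (d + d ∣_) (ℕ.+-comm 1 (n + d)) (oddMult⇒∣ d (suc n) oddMult-1+n)) (oddMult⇒∣ d n oddMult-n)
    d+d≢1 : ∀ d → d + d ≢ 1
    d+d≢1 zero ()
    d+d≢1 (suc d) 2+2d≡1 = contradiction (ℕ.m+n≡0⇒n≡0 d (ℕ.suc-injective 2+2d≡1)) (λ ())

  roundHalf-α : ∀ d m → roundHalf (suc (suc m)) d ≡ α d (suc (suc m)) + roundHalf m d
  roundHalf-α d m rewrite roundHalf-suc d (suc m) | roundHalf-suc d m
    with oddMult d (suc (suc m)) in eq₂ | oddMult d (suc m) in eq₁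
  ... | true  | true  = contradiction (subst T (sym eq₂) _) (oddMult-not-consecutive d (suc m) (subst T (sym eq₁) _))
  ... | true  | false = refl
  ... | false | true  = refl
  ... | false | false = refl

  roundHalf-small : ∀ j d → j < d → roundHalf j d ≡ 0
  roundHalf-small j d@(suc _) j<d = m<n⇒m/n≡0 (ℕ.+-monoˡ-< d j<d)

open RoundHalf using (roundHalf-suc; roundHalf-α; roundHalf-small)

ℤ[z] : CommutativeRing 0ℓ 0ℓ
ℤ[z] = Polynomial.commutativeRing ℤ.+-*-commutativeRing

module ℤ[z] where
  open Polynomial ℤ.+-*-commutativeRing public
  open CommutativeRing ℤ[z] public using (_*_; _-_)

  zero≟ : ∀ p → Maybe ([] ≋ p)
  zero≟ = zero? (AlmostCommutativeRing.0≟_ ℤ-Solver.ring)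

module ℤ[z][q] = Polynomial ℤ[z]

ℤ[z][q] : CommutativeRing 0ℓ 0ℓ
ℤ[z][q] = ℤ[z][q].commutativeRing

ℤ[z][q]-ring : AlmostCommutativeRing 0ℓ 0ℓ
ℤ[z][q]-ring = fromCommutativeRing ℤ[z][q] (ℤ[z][q].zero? ℤ[z].zero≟)

module ℤ[ζ][q] (φ : PZ) where
  ℤ[ζ] : CommutativeRing 0ℓ 0ℓ
  ℤ[ζ] = PrincipalQuotient.quotientRing ℤ[z] φ

  ℤ[ζ][q] : CommutativeRing 0ℓ 0ℓ
  ℤ[ζ][q] = Polynomial.commutativeRing ℤ[ζ]

  open CommutativeRing ℤ[ζ][q] public

  -- The reflective ring solver needs a closed ring, so ring identities are proved in ℤ[z][q]
  -- and transported here.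
  ≋⇒≈ : ∀ {P P′} → CommutativeRing._≈_ ℤ[z][q] P P′ → P ≈ P′
  ≋⇒≈ P≋P′ = Polynomial.mk≋ λ i → PrincipalQuotient.≈⇒≈φ ℤ[z] φ (Polynomial.coeff-≈ P≋P′ i)

module _ (Φ : ℕ → PZ) (c : ℕ) where
  open ℤ[ζ][q] (Φ (2 ℕ.* c))
  open import Relation.Binary.Reasoning.Setoid (CommutativeRing.setoid ℤ[z])

  private
    φ : PZ
    φ = Φ (2 ℕ.* c)

  Eqζ⇒≈ : ∀ {P P′} → Eqζ Φ c P P′ → P ≈ P′
  Eqζ⇒≈ {P} {P′} (H , P-P′≡φH) = Polynomial.mk≋ λ i → ZQ.coeff H i , (begin
    ZQ.coeff P i ℤ[z].- ZQ.coeff P′ i    ≈⟨ ℤ[z][q].coeff-sub P P′ i ⟨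
    ZQ.coeff (ZQ.sub P P′) i             ≈⟨ ℤ[z].mk≋ (P-P′≡φH i) ⟩
    ZQ.coeff (ZQ.mul (φ ∷ []) H) i       ≈⟨ ℤ[z][q].coeff-≈ (ℤ[z][q].mul-constantˡ φ H) i ⟩
    ZQ.coeff (ZQ.scale φ H) i            ≈⟨ ℤ[z][q].coeff-scale φ H i ⟩
    φ ℤ[z].* ZQ.coeff H i                ∎)

  ≈⇒multiple : ∀ {P P′} → P ≈ P′ → ∀ i → Σ PZ λ h → ZQ.coeff (ZQ.sub P P′) i ℤ[z].≋ φ ℤ[z].* h
  ≈⇒multiple {P} {P′} P≈P′ i with Polynomial.coeff-≈ P≈P′ i
  ... | h , P-P′≋φh = h , ℤ[z].≋-trans (ℤ[z][q].coeff-sub P P′ i) P-P′≋φh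

  ≈⇒Eqζ : ∀ {P P′} → P ≈ P′ → Eqζ Φ c P P′
  ≈⇒Eqζ {P} {P′} P≈P′ with ℤ[z][q].coefficients-multiple⇒scale φ (ZQ.sub P P′) (≈⇒multiple P≈P′)
  ... | H , P-P′≋φH = H , λ i j → ℤ[z].coeff-≈ (ℤ[z][q].coeff-≈ P-P′≋φ∷[]H i) j
    where
    P-P′≋φ∷[]H : ZQ.sub P P′ ℤ[z][q].≋ ZQ.mul (φ ∷ []) H
    P-P′≋φ∷[]H = ℤ[z][q].≋-trans P-P′≋φH (ℤ[z][q].≋-sym (ℤ[z][q].mul-constantˡ φ H))

-- The solver does not recognise AlmostCommutativeRing._-_ (which also has no fixity),
-- so differences are written x + - y below.
module QBinomials where
  open import Data.Fin using (toℕ; inject₁; fromℕ)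
  open import Data.Fin.Properties using (toℕ-inject₁; toℕ-fromℕ; toℕ<n)
  open import Data.Nat using (_∸_)
  open AlmostCommutativeRing ℤ[z][q]-ring hiding (zero)
  open import Algebra.Properties.Semiring.Sum semiring
    using (sum-syntax; sum-cong-≋; sum-init-last; ∑-distrib-+; *-distribˡ-sum)
  open import Relation.Binary.Reasoning.Setoid setoid
  open import Algebra.Properties.CommutativeSemigroup (CommutativeSemiring.*-commutativeSemigroup commutativeSemiring)
    using (x∙yz≈yx∙z)
  open import Algebra.Properties.CommutativeSemigroup (CommutativeSemiring.+-commutativeSemigroup commutativeSemiring)
    using (x∙yz≈xz∙y)

  powQ-+ : ∀ p m n → powQ p (m ℕ.+ n) ≈ powQ p m * powQ p n
  powQ-+ p zero n = sym (*-identityˡ (powQ p n))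
  powQ-+ p (suc m) n = trans (*-congˡ {p} (powQ-+ p m n)) (sym (*-assoc p (powQ p m) (powQ p n)))

  powQ-∸-+ : ∀ p {m n} → m ℕ.≤ n → powQ p (n ∸ m) * powQ p m ≈ powQ p n
  powQ-∸-+ p {m} {n} m≤n = trans (sym (powQ-+ p (n ∸ m) m)) (reflexive (≡.cong (powQ p) (ℕ.m∸n+n≡m m≤n)))

  *-vanishʳ : ∀ p {r} → r ≈ 0# → p * r ≈ 0#
  *-vanishʳ p r≈0 = trans (*-congˡ {p} r≈0) (zeroʳ p)

  qbinom-vanish : ∀ n m → n < m → qbinom n m ≈ 0#
  qbinom-vanish zero (suc m) _ = refl
  qbinom-vanish (suc n) (suc m) (s≤s n<m) = begin
    qbinom n m + powQ qQ (suc m) * qbinom n (suc m)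
      ≈⟨ +-cong (qbinom-vanish n m n<m) (*-vanishʳ (powQ qQ (suc m)) (qbinom-vanish n (suc m) (ℕ.m<n⇒m<1+n n<m))) ⟩
    0# + 0#
      ≈⟨ +-identityˡ 0# ⟩
    0# ∎

  -- Defs defines qbinom by the first q-Pascal rule; this is the second one.
  qbinom-pascal′ : ∀ n m → qbinom (suc n) (suc m) ≈ powQ qQ (n ∸ m) * qbinom n m + qbinom n (suc m)
  qbinom-pascal′ zero zero = lemma qQ
    where
    lemma : ∀ x → 1# + x * 1# * 0# ≈ 1# * 1# + 0#
    lemma = solve-∀ ℤ[z][q]-ring
  qbinom-pascal′ zero (suc m) = begin
    0# + powQ qQ (suc (suc m)) * 0#   ≈⟨ +-identityˡ _ ⟩
    powQ qQ (suc (suc m)) * 0#        ≈⟨ zeroʳ (powQ qQ (suc (suc m))) ⟩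
    0#                                ≈⟨ zeroʳ 1# ⟨
    1# * 0#                           ≈⟨ +-identityʳ _ ⟨
    1# * 0# + 0#                      ∎
  qbinom-pascal′ (suc n) zero = begin
    1# + qQ * 1# * qbinom (suc n) 1                   ≈⟨ +-congˡ {1#} (*-congˡ {qQ * 1#} (qbinom-pascal′ n zero)) ⟩
    1# + qQ * 1# * (powQ qQ n * 1# + qbinom n 1)      ≈⟨ lemma qQ (powQ qQ n) (qbinom n 1) ⟩
    qQ * powQ qQ n * 1# + (1# + qQ * 1# * qbinom n 1) ∎
    where
    lemma : ∀ x y w → 1# + x * 1# * (y * 1# + w) ≈ x * y * 1# + (1# + x * 1# * w)
    lemma = solve-∀ ℤ[z][q]-ring
  qbinom-pascal′ (suc n) (suc m) = begin
    qbinom (suc n) (suc m) + b * qbinom (suc n) (suc (suc m))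
      ≈⟨ +-cong (qbinom-pascal′ n m) (*-congˡ {b} (qbinom-pascal′ n (suc m))) ⟩
    (a * X + Y) + b * (a′ * Y + Z)
      ≈⟨ lemma₁ a X Y b a′ Z ⟩
    (a * X + Y + b * Z) + b * (a′ * Y)
      ≈⟨ +-congˡ equal-weights ⟩
    (a * X + Y + b * Z) + a * (b′ * Y)
      ≈⟨ lemma₂ a X Y b b′ Z ⟩
    a * (X + b′ * Y) + (Y + b * Z) ∎
    where
    a a′ b b′ X Y Z : PZQ
    a = powQ qQ (n ∸ m)
    a′ = powQ qQ (n ∸ suc m)
    b = powQ qQ (suc (suc m))
    b′ = powQ qQ (suc m)
    X = qbinom n m
    Y = qbinom n (suc m)
    Z = qbinom n (suc (suc m))
    lemma₁ : ∀ a X Y b a′ Z → (a * X + Y) + b * (a′ * Y + Z) ≈ (a * X + Y + b * Z) + b * (a′ * Y)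
    lemma₁ = solve-∀ ℤ[z][q]-ring
    lemma₂ : ∀ a X Y b b′ Z → (a * X + Y + b * Z) + a * (b′ * Y) ≈ a * (X + b′ * Y) + (Y + b * Z)
    lemma₂ = solve-∀ ℤ[z][q]-ring
    equal-weights : b * (a′ * Y) ≈ a * (b′ * Y)
    equal-weights with m ℕ.<? n
    ... | yes m<n = begin
      b * (a′ * Y)   ≈⟨ x∙yz≈yx∙z b a′ Y ⟩
      a′ * b * Y     ≈⟨ *-congʳ (powQ-∸-+ qQ (s≤s m<n)) ⟩
      powQ qQ (suc n) * Y   ≈⟨ *-congʳ (powQ-∸-+ qQ (s≤s (ℕ.<⇒≤ m<n))) ⟨
      a * b′ * Y     ≈⟨ *-assoc a b′ Y ⟩
      a * (b′ * Y)   ∎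
    ... | no m≮n = trans (*-vanishʳ b (*-vanishʳ a′ Y≈0)) (sym (*-vanishʳ a (*-vanishʳ b′ Y≈0)))
      where
      Y≈0 : Y ≈ 0#
      Y≈0 = qbinom-vanish n (suc m) (s≤s (ℕ.≮⇒≥ m≮n))

  sumQ-map-applyUpTo : ∀ (g : ℕ → PZQ) (f : ℕ → ℕ) N → sumQ (map g (applyUpTo f N)) ≡ ∑[ i < N ] g (f (toℕ i))
  sumQ-map-applyUpTo g f zero = ≡.refl
  sumQ-map-applyUpTo g f (suc N) = ≡.cong (g (f 0) +_) (sumQ-map-applyUpTo g (λ i → f (suc i)) N)

  sum-init : ∀ n (f : ℕ → PZQ) → f n ≈ 0# → ∑[ i < suc n ] f (toℕ i) ≈ ∑[ i < n ] f (toℕ i)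
  sum-init n f fn≈0 = begin
    ∑[ i < suc n ] f (toℕ i)                                ≈⟨ sum-init-last (λ i → f (toℕ i)) ⟩
    ∑[ i < n ] f (toℕ (inject₁ i)) + f (toℕ (fromℕ n))     ≈⟨ +-cong (sum-cong-≋ {n} λ i → reflexive (≡.cong f (toℕ-inject₁ i)))
                                                                      (trans (reflexive (≡.cong f (toℕ-fromℕ n))) fn≈0) ⟩
    ∑[ i < n ] f (toℕ i) + 0#                               ≈⟨ +-identityʳ _ ⟩
    ∑[ i < n ] f (toℕ i)                                    ∎

  ζ^_[_,_] : ℕ → ℕ → ℕ → PZQ
  ζ^ m [ n , k ] = powQ zetaQ m * qbinom n k

  Qn-sum : ∀ n → Qn n ≡ ∑[ i < suc n ] ζ^ toℕ i [ n , toℕ i ]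
  Qn-sum n = sumQ-map-applyUpTo (λ m → ζ^ m [ n , m ]) (λ i → i) (suc n)

  twisted-term : ℕ → ℕ → PZQ
  twisted-term n m = powQ qQ (n ∸ m) * ζ^ m [ n , m ]

  Qn-twisted : ℕ → PZQ
  Qn-twisted n = ∑[ i < suc n ] twisted-term n (toℕ i)

  Qn-suc : ∀ n → Qn (suc n) ≈ Qn n + zetaQ * Qn-twisted n
  Qn-suc n rewrite Qn-sum (suc n) | Qn-sum n = begin
    ζ^ 0 [ n , 0 ] + ∑[ i < suc n ] ζ^ suc (toℕ i) [ suc n , suc (toℕ i) ]
      ≈⟨ +-congˡ {ζ^ 0 [ n , 0 ]} (sum-cong-≋ {suc n} λ i → pascal-term (toℕ i)) ⟩
    ζ^ 0 [ n , 0 ] + ∑[ i < suc n ] (zetaQ * twisted-term n (toℕ i) + ζ^ suc (toℕ i) [ n , suc (toℕ i) ])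
      ≈⟨ +-congˡ {ζ^ 0 [ n , 0 ]} (∑-distrib-+ {suc n} (λ i → zetaQ * twisted-term n (toℕ i))
                                                        (λ i → ζ^ suc (toℕ i) [ n , suc (toℕ i) ])) ⟩
    ζ^ 0 [ n , 0 ] + (∑[ i < suc n ] (zetaQ * twisted-term n (toℕ i)) + ∑[ i < suc n ] ζ^ suc (toℕ i) [ n , suc (toℕ i) ])
      ≈⟨ +-congˡ {ζ^ 0 [ n , 0 ]} (+-cong (sym (*-distribˡ-sum {suc n} zetaQ (λ i → twisted-term n (toℕ i))))
                                           (sum-init n (λ m → ζ^ suc m [ n , suc m ]) last-vanishes)) ⟩
    ζ^ 0 [ n , 0 ] + (zetaQ * Qn-twisted n + ∑[ i < n ] ζ^ suc (toℕ i) [ n , suc (toℕ i) ])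
      ≈⟨ x∙yz≈xz∙y (ζ^ 0 [ n , 0 ]) (zetaQ * Qn-twisted n) (∑[ i < n ] ζ^ suc (toℕ i) [ n , suc (toℕ i) ]) ⟩
    ζ^ 0 [ n , 0 ] + ∑[ i < n ] ζ^ suc (toℕ i) [ n , suc (toℕ i) ] + zetaQ * Qn-twisted n ∎
    where
    pascal-term : ∀ m → ζ^ suc m [ suc n , suc m ] ≈ zetaQ * twisted-term n m + ζ^ suc m [ n , suc m ]
    pascal-term m = trans (*-congˡ {zetaQ * powQ zetaQ m} (qbinom-pascal′ n m))
      (lemma zetaQ (powQ zetaQ m) (powQ qQ (n ∸ m)) (qbinom n m) (qbinom n (suc m)))
      where
      lemma : ∀ z zm a X Y → (z * zm) * (a * X + Y) ≈ z * (a * (zm * X)) + (z * zm) * Y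
      lemma = solve-∀ ℤ[z][q]-ring
    last-vanishes : ζ^ suc n [ n , suc n ] ≈ 0#
    last-vanishes = *-vanishʳ (powQ zetaQ (suc n)) (qbinom-vanish n (suc n) (ℕ.n<1+n n))

  shifted-term : ℕ → ℕ → PZQ
  shifted-term n m = powQ qQ (n ∸ m) * (powQ zetaQ (suc m) * (powQ qQ (suc m) * qbinom n (suc m)))

  ∑-shifted-term : ∀ n → ∑[ i < suc n ] shifted-term n (toℕ i) ≈
                         powQ qQ (suc n) * ∑[ i < n ] ζ^ suc (toℕ i) [ n , suc (toℕ i) ]
  ∑-shifted-term n = begin
    ∑[ i < suc n ] shifted-term n (toℕ i)
      ≈⟨ sum-init n (shifted-term n) (*-vanishʳ (powQ qQ (n ∸ n)) (*-vanishʳ (powQ zetaQ (suc n))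
           (*-vanishʳ (powQ qQ (suc n)) (qbinom-vanish n (suc n) (ℕ.n<1+n n))))) ⟩
    ∑[ i < n ] shifted-term n (toℕ i)
      ≈⟨ sum-cong-≋ {n} (λ i → shifted-term-< (toℕ i) (toℕ<n i)) ⟩
    ∑[ i < n ] (powQ qQ (suc n) * ζ^ suc (toℕ i) [ n , suc (toℕ i) ])
      ≈⟨ *-distribˡ-sum {n} (powQ qQ (suc n)) (λ i → ζ^ suc (toℕ i) [ n , suc (toℕ i) ]) ⟨
    powQ qQ (suc n) * ∑[ i < n ] ζ^ suc (toℕ i) [ n , suc (toℕ i) ] ∎
    where
    shifted-term-< : ∀ m → m < n → shifted-term n m ≈ powQ qQ (suc n) * ζ^ suc m [ n , suc m ]
    shifted-term-< m m<n = begin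
      powQ qQ (n ∸ m) * (powQ zetaQ (suc m) * (powQ qQ (suc m) * qbinom n (suc m)))
        ≈⟨ lemma (powQ qQ (n ∸ m)) (powQ zetaQ (suc m)) (powQ qQ (suc m)) (qbinom n (suc m)) ⟩
      powQ qQ (n ∸ m) * powQ qQ (suc m) * ζ^ suc m [ n , suc m ]
        ≈⟨ *-congʳ (powQ-∸-+ qQ (s≤s (ℕ.<⇒≤ m<n))) ⟩
      powQ qQ (suc n) * ζ^ suc m [ n , suc m ] ∎
      where
      lemma : ∀ a zm b Y → a * (zm * (b * Y)) ≈ (a * b) * (zm * Y)
      lemma = solve-∀ ℤ[z][q]-ring

  Qn-twisted-suc : ∀ n → Qn-twisted (suc n) ≈ zetaQ * Qn-twisted n + powQ qQ (suc n) * Qn n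
  Qn-twisted-suc n rewrite Qn-sum n = begin
    q^n+1 * ζ^ 0 [ n , 0 ] + ∑[ i < suc n ] (powQ qQ (n ∸ toℕ i) * ζ^ suc (toℕ i) [ suc n , suc (toℕ i) ])
      ≈⟨ +-congˡ {q^n+1 * ζ^ 0 [ n , 0 ]} (sum-cong-≋ {suc n} λ i → pascal-term (toℕ i)) ⟩
    q^n+1 * ζ^ 0 [ n , 0 ] + ∑[ i < suc n ] (zetaQ * twisted-term n (toℕ i) + shifted-term n (toℕ i))
      ≈⟨ +-congˡ {q^n+1 * ζ^ 0 [ n , 0 ]} (∑-distrib-+ {suc n} (λ i → zetaQ * twisted-term n (toℕ i))
                                                                (λ i → shifted-term n (toℕ i))) ⟩
    q^n+1 * ζ^ 0 [ n , 0 ] + (∑[ i < suc n ] (zetaQ * twisted-term n (toℕ i)) + ∑[ i < suc n ] shifted-term n (toℕ i))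
      ≈⟨ +-congˡ {q^n+1 * ζ^ 0 [ n , 0 ]} (+-cong (sym (*-distribˡ-sum {suc n} zetaQ (λ i → twisted-term n (toℕ i))))
                                                   (∑-shifted-term n)) ⟩
    q^n+1 * ζ^ 0 [ n , 0 ] + (zetaQ * Qn-twisted n + q^n+1 * ∑[ i < n ] ζ^ suc (toℕ i) [ n , suc (toℕ i) ])
      ≈⟨ lemma q^n+1 (ζ^ 0 [ n , 0 ]) (zetaQ * Qn-twisted n) (∑[ i < n ] ζ^ suc (toℕ i) [ n , suc (toℕ i) ]) ⟩
    zetaQ * Qn-twisted n + q^n+1 * (ζ^ 0 [ n , 0 ] + ∑[ i < n ] ζ^ suc (toℕ i) [ n , suc (toℕ i) ]) ∎
    where
    q^n+1 : PZQ
    q^n+1 = powQ qQ (suc n)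
    lemma : ∀ a o b t → a * o + (b + a * t) ≈ b + a * (o + t)
    lemma = solve-∀ ℤ[z][q]-ring
    pascal-term : ∀ m → powQ qQ (n ∸ m) * ζ^ suc m [ suc n , suc m ] ≈ zetaQ * twisted-term n m + shifted-term n m
    pascal-term m =
      lemma′ (powQ qQ (n ∸ m)) zetaQ (powQ zetaQ m) (qbinom n m) (powQ qQ (suc m) * qbinom n (suc m))
      where
      lemma′ : ∀ a z zm X Y → a * ((z * zm) * (X + Y)) ≈ z * (a * (zm * X)) + a * ((z * zm) * Y)
      lemma′ = solve-∀ ℤ[z][q]-ring

  Qn-recurrence : ∀ m → Qn (suc (suc m)) ≈ (1# + zetaQ) * Qn (suc m) + - (zetaQ * (1# + - powQ qQ (suc m)) * Qn m)
  Qn-recurrence m = begin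
    Qn (suc (suc m))
      ≈⟨ Qn-suc (suc m) ⟩
    Qn (suc m) + zetaQ * Qn-twisted (suc m)
      ≈⟨ +-cong (Qn-suc m) (*-congˡ {zetaQ} (Qn-twisted-suc m)) ⟩
    (Qn m + zetaQ * Qn-twisted m) + zetaQ * (zetaQ * Qn-twisted m + powQ qQ (suc m) * Qn m)
      ≈⟨ lemma (Qn m) zetaQ (Qn-twisted m) (powQ qQ (suc m)) ⟩
    (1# + zetaQ) * (Qn m + zetaQ * Qn-twisted m) + - (zetaQ * (1# + - powQ qQ (suc m)) * Qn m)
      ≈⟨ +-congʳ { - (zetaQ * (1# + - powQ qQ (suc m)) * Qn m)} (*-congˡ {1# + zetaQ} (Qn-suc m)) ⟨
    (1# + zetaQ) * Qn (suc m) + - (zetaQ * (1# + - powQ qQ (suc m)) * Qn m) ∎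
    where
    lemma : ∀ g z f Q → (g + z * f) + z * (z * f + Q * g) ≈ (1# + z) * (g + z * f) + - (z * (1# + - Q) * g)
    lemma = solve-∀ ℤ[z][q]-ring

  recurrence-identity : ∀ R₂ A E u R₁ B w R₀ →
    (R₂ * A + - (u * R₁ * B + - (w * R₀))) * E ≈ R₂ * (A * E) + - (u * (R₁ * (B * E)) + - (w * (R₀ * E)))
  recurrence-identity = solve-∀ ℤ[z][q]-ring

open QBinomials using (Qn-recurrence; recurrence-identity)

module OddProducts where
  open import Data.List.Properties using (applyUpTo-∷ʳ)
  open import Relation.Nullary using (does)
  open import Relation.Unary using (Decidable)
  open QBinomials using (powQ-+)
  open AlmostCommutativeRing ℤ[z][q]-ring hiding (zero)
  open import Relation.Binary.Reasoning.Setoid setoid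

  prodQ-map-* : ∀ (l : List ℕ) f g → prodQ (map (λ k → f k * g k) l) ≈ prodQ (map f l) * prodQ (map g l)
  prodQ-map-* [] f g = sym (*-identityˡ 1#)
  prodQ-map-* (k ∷ l) f g = trans (*-congˡ {f k * g k} (prodQ-map-* l f g))
    (lemma (f k) (g k) (prodQ (map f l)) (prodQ (map g l)))
    where
    lemma : ∀ a b c d → (a * b) * (c * d) ≈ (a * c) * (b * d)
    lemma = solve-∀ ℤ[z][q]-ring

  prodQ-map-cong : ∀ (l : List ℕ) {f g} → (∀ k → f k ≈ g k) → prodQ (map f l) ≈ prodQ (map g l)
  prodQ-map-cong [] f≈g = refl
  prodQ-map-cong (k ∷ l) f≈g = *-cong (f≈g k) (prodQ-map-cong l f≈g)

  prodQ-filter-∷ʳ : ∀ {P : ℕ → Set} (P? : Decidable P) f xs x → f x ≈ 1# →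
                    prodQ (map f (filter P? (xs ∷ʳ x))) ≈ prodQ (map f (filter P? xs))
  prodQ-filter-∷ʳ P? f [] x fx≈1 with does (P? x)
  ... | true = trans (*-identityʳ (f x)) fx≈1
  ... | false = refl
  prodQ-filter-∷ʳ P? f (y ∷ xs) x fx≈1 with does (P? y)
  ... | true = *-congˡ {f y} (prodQ-filter-∷ʳ P? f xs x fx≈1)
  ... | false = prodQ-filter-∷ʳ P? f xs x fx≈1

  module _ (Φ : ℕ → PZ) (c : ℕ) where
    private
      odd? : Decidable (λ k → isOdd k ≡ true)
      odd? k = isOdd k Data.Bool.≟ true
      factor : (ℕ → ℕ) → ℕ → PZQ
      factor e k = powQ (inQ (Φ (k ℕ.* c))) (e k)

    oddProd-+ : ∀ N e e′ → oddProd Φ c N (λ k → e k ℕ.+ e′ k) ≈ oddProd Φ c N e * oddProd Φ c N e′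
    oddProd-+ N e e′ = trans (prodQ-map-cong (filter odd? (applyUpTo suc N)) λ k → powQ-+ (inQ (Φ (k ℕ.* c))) (e k) (e′ k))
                             (prodQ-map-* (filter odd? (applyUpTo suc N)) (factor e) (factor e′))

    oddProd-cong : ∀ N {e e′} → (∀ k → e k ≡ e′ k) → oddProd Φ c N e ≈ oddProd Φ c N e′
    oddProd-cong N {e} {e′} e≗e′ =
      prodQ-map-cong (filter odd? (applyUpTo suc N)) λ k → reflexive (≡.cong (powQ (inQ (Φ (k ℕ.* c)))) (e≗e′ k))

    oddProd-suc : ∀ N e → e (suc N) ≡ 0 → oddProd Φ c (suc N) e ≈ oddProd Φ c N e
    oddProd-suc N e e[1+N]≡0 = begin
      prodQ (map (factor e) (filter odd? (applyUpTo suc (suc N))))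
        ≡⟨ ≡.cong (λ l → prodQ (map (factor e) (filter odd? l))) (applyUpTo-∷ʳ suc N) ⟨
      prodQ (map (factor e) (filter odd? (applyUpTo suc N ∷ʳ suc N)))
        ≈⟨ prodQ-filter-∷ʳ odd? (factor e) (applyUpTo suc N) (suc N)
             (reflexive (≡.cong (powQ (inQ (Φ (suc N ℕ.* c)))) e[1+N]≡0)) ⟩
      prodQ (map (factor e) (filter odd? (applyUpTo suc N))) ∎

  module _ (Φ : ℕ → PZ) {c : ℕ} (1≤c : 1 ℕ.≤ c) (m : ℕ) where
    private
      M : ℕ
      M = suc (suc m)
      P : ℕ → ℕ → PZQ
      P j N = oddProd Φ c N (λ k → roundHalf j (k ℕ.* c))
      E : PZQ
      E = P m M
      n<n*c : ∀ n → n < suc n ℕ.* c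
      n<n*c n = ℕ.<-≤-trans (ℕ.n<1+n n) (≡.subst (ℕ._≤ suc n ℕ.* c) (ℕ.*-identityʳ (suc n)) (ℕ.*-monoʳ-≤ (suc n) 1≤c))

    oddProd-roundHalf-extend : P m m ≈ E
    oddProd-roundHalf-extend = sym (trans (oddProd-suc Φ c (suc m) (λ k → roundHalf m (k ℕ.* c)) (roundHalf-small m (M ℕ.* c) m<M*c))
                                          (oddProd-suc Φ c m (λ k → roundHalf m (k ℕ.* c)) (roundHalf-small m (suc m ℕ.* c) (n<n*c m))))
      where
      m<M*c : m < M ℕ.* c
      m<M*c = ℕ.<-trans (ℕ.n<1+n m) (n<n*c (suc m))

    oddProd-roundHalf-suc : P (suc m) (suc m) ≈ oddProd Φ c M (λ k → β (k ℕ.* c) M) * E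
    oddProd-roundHalf-suc = trans (sym (oddProd-suc Φ c (suc m) (λ k → roundHalf (suc m) (k ℕ.* c)) (roundHalf-small (suc m) (M ℕ.* c) (n<n*c (suc m)))))
      (trans (oddProd-cong Φ c M (λ k → roundHalf-suc (k ℕ.* c) m))
             (oddProd-+ Φ c M (λ k → β (k ℕ.* c) M) (λ k → roundHalf m (k ℕ.* c))))

    oddProd-roundHalf-suc-suc : P M M ≈ oddProd Φ c M (λ k → α (k ℕ.* c) M) * E
    oddProd-roundHalf-suc-suc = trans (oddProd-cong Φ c M (λ k → roundHalf-α (k ℕ.* c) m))
      (oddProd-+ Φ c M (λ k → α (k ℕ.* c) M) (λ k → roundHalf m (k ℕ.* c)))

open OddProducts using (oddProd-roundHalf-extend; oddProd-roundHalf-suc; oddProd-roundHalf-suc-suc)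

module _ where
  open CommutativeRing ℤ[z]
  open import Algebra.Properties.CommutativeSemigroup *-commutativeSemigroup using (x∙yz≈y∙xz)

  prodZ-∈ : ∀ (Φ : ℕ → PZ) {xs x} → x ∈ xs → Σ PZ λ r → prodZ (map Φ xs) ≈ Φ x * r
  prodZ-∈ Φ {y ∷ ys} (here ≡.refl) = prodZ (map Φ ys) , refl
  prodZ-∈ Φ {y ∷ ys} {x} (there x∈ys) with prodZ-∈ Φ x∈ys
  ... | r , prod≈Φx*r = Φ y * r , trans (*-congˡ {Φ y} prod≈Φx*r) (x∙yz≈y∙xz (Φ y) (Φ x) r)

  cyclotomic-∣ : ∀ {Φ} → IsCyclotomicFamily Φ → ∀ N → 1 ≤ N → Σ PZ λ r → Φ N * r ≈ Z.sub (powZ varZ N) oneZ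
  cyclotomic-∣ {Φ} isCyclotomic N@(suc N-1) 1≤N with prodZ-∈ Φ N∈divisors
    where
    N∈divisors : N ∈ filter (_∣? N) (applyUpTo suc N)
    N∈divisors = ∈-filter⁺ (_∣? N) (∈-applyUpTo⁺ suc (ℕ.n<1+n N-1)) ∣-refl
  ... | r , prod≈ΦN*r = r , trans (sym prod≈ΦN*r) (Polynomial.mk≋ (isCyclotomic N 1≤N))

module _ (φ : PZ) where
  open ℤ[ζ][q] φ
  open NonZeroDivisors ℤ[ζ][q]
  open PolynomialVariable ℤ[ζ] using (X; X^-1-nonZeroDivisor)
  open import Algebra.Properties.Semiring.Exp semiring using (_^_)
  open import Relation.Binary.Reasoning.Setoid setoid

  inQ-isRingHomomorphism : IsRingHomomorphism (CommutativeRing.rawRing ℤ.+-*-commutativeRing)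
                                              (CommutativeRing.rawRing ℤ[ζ]) (_∷ [])
  inQ-isRingHomomorphism = Composition.isRingHomomorphism (λ {x y z} → PrincipalQuotient.≈φ-trans ℤ[z] φ {x} {y} {z})
    (Polynomial.constant-isRingHomomorphism ℤ.+-*-commutativeRing)
    (PrincipalQuotient.projection-isRingHomomorphism ℤ[z] φ)

  open PolynomialMap {R = ℤ.+-*-commutativeRing} {S = ℤ[ζ]} inQ-isRingHomomorphism

  inQ-powZ : ∀ N → inQ (powZ varZ N) ≈ X ^ N
  inQ-powZ zero = refl
  inQ-powZ (suc N) = trans (map-mul varZ (powZ varZ N)) (*-cong map-X (inQ-powZ N))

  Φ-nonZeroDivisor : ∀ {Φ} → IsCyclotomicFamily Φ → ∀ N → 1 ≤ N → NonZeroDivisor (inQ (Φ N))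
  Φ-nonZeroDivisor {Φ} isCyclotomic N 1≤N with cyclotomic-∣ isCyclotomic N 1≤N
  ... | r , ΦN*r≈X^N-1 = nonZeroDivisor-∣ (inQ r) (begin
    inQ (Φ N) * inQ r                        ≈⟨ map-mul (Φ N) r ⟨
    inQ (Z.mul (Φ N) r)                      ≈⟨ map-cong ΦN*r≈X^N-1 ⟩
    inQ (Z.sub (powZ varZ N) oneZ)           ≈⟨ map-add (powZ varZ N) (Z.negP oneZ) ⟩
    inQ (powZ varZ N) + inQ (Z.negP oneZ)    ≈⟨ +-cong (inQ-powZ N) (map-negP oneZ) ⟩
    X ^ N - 1#                               ∎) (X^-1-nonZeroDivisor N 1≤N)

  powQ-nonZeroDivisor : ∀ {a} → NonZeroDivisor a → ∀ n → NonZeroDivisor (powQ a n)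
  powQ-nonZeroDivisor nzd-a zero = nonZeroDivisor-1
  powQ-nonZeroDivisor nzd-a (suc n) = nonZeroDivisor-* nzd-a (powQ-nonZeroDivisor nzd-a n)

  prodQ-nonZeroDivisor : ∀ (f : ℕ → PZQ) {l} → All (NonZeroDivisor ∘ f) l → NonZeroDivisor (prodQ (map f l))
  prodQ-nonZeroDivisor f [] = nonZeroDivisor-1
  prodQ-nonZeroDivisor f (nzd-fk ∷ nzd-fl) = nonZeroDivisor-* nzd-fk (prodQ-nonZeroDivisor f nzd-fl)

  oddProd-nonZeroDivisor : ∀ {Φ} → IsCyclotomicFamily Φ → ∀ c → 1 ≤ c → ∀ N e → NonZeroDivisor (oddProd Φ c N e)
  oddProd-nonZeroDivisor {Φ} isCyclotomic c 1≤c N e = prodQ-nonZeroDivisor _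
    (All.filter⁺ (λ k → isOdd k Data.Bool.≟ true) (All.applyUpTo⁺₁ suc N λ {k} _ →
      powQ-nonZeroDivisor (Φ-nonZeroDivisor isCyclotomic (suc k ℕ.* c) (ℕ.*-mono-≤ {1} {suc k} (s≤s ℕ.z≤n) 1≤c)) (e (suc k))))

module _ {Φ : ℕ → PZ} (isCyclotomic : IsCyclotomicFamily Φ) {c : ℕ} (1≤c : 1 ℕ.≤ c) (R : ℕ → PZQ)
         (Qn≈RP : ∀ j → Eqζ Φ c (Qn j) (ZQ.mul (R j) (oddProd Φ c j (λ k → roundHalf j (k ℕ.* c)))))
         (m : ℕ) where
  open ℤ[ζ][q] (Φ (2 ℕ.* c))
  open import Algebra.Properties.Group +-group using (x∙y⁻¹≈ε⇒x≈y)
  open import Relation.Binary.Reasoning.Setoid setoid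

  private
    M : ℕ
    M = suc (suc m)
    A B E u w : PZQ
    A = oddProd Φ c M (λ k → α (k ℕ.* c) M)
    B = oddProd Φ c M (λ k → β (k ℕ.* c) M)
    E = oddProd Φ c M (λ k → roundHalf m (k ℕ.* c))
    u = 1# + zetaQ
    w = zetaQ * (1# - powQ qQ (suc m))

    Qn≈R*P : ∀ j {P} → oddProd Φ c j (λ k → roundHalf j (k ℕ.* c)) ≈ P → Qn j ≈ R j * P
    Qn≈R*P j P≈ = trans (Eqζ⇒≈ Φ c (Qn≈RP j)) (*-congˡ {R j} P≈)

    difference*E≈0 : (R M * A - (u * R (suc m) * B - w * R m)) * E ≈ 0#
    difference*E≈0 = begin
      (R M * A - (u * R (suc m) * B - w * R m)) * E
        ≈⟨ ≋⇒≈ (recurrence-identity (R M) A E u (R (suc m)) B w (R m)) ⟩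
      R M * (A * E) - (u * (R (suc m) * (B * E)) - w * (R m * E))
        ≈⟨ +-cong (sym (Qn≈R*P M (≋⇒≈ (oddProd-roundHalf-suc-suc Φ 1≤c m))))
                  (-‿cong (+-cong (*-congˡ {u} (sym (Qn≈R*P (suc m) (≋⇒≈ (oddProd-roundHalf-suc Φ 1≤c m)))))
                                  (-‿cong (*-congˡ {w} (sym (Qn≈R*P m (≋⇒≈ (oddProd-roundHalf-extend Φ 1≤c m)))))))) ⟩
      Qn M - (u * Qn (suc m) - w * Qn m)
        ≈⟨ +-congʳ { - (u * Qn (suc m) - w * Qn m)} (≋⇒≈ (Qn-recurrence m)) ⟩
      (u * Qn (suc m) - w * Qn m) - (u * Qn (suc m) - w * Qn m)
        ≈⟨ -‿inverseʳ (u * Qn (suc m) - w * Qn m) ⟩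
      0# ∎

  R-recurrence : R M * A ≈ u * R (suc m) * B - w * R m
  R-recurrence = x∙y⁻¹≈ε⇒x≈y (R M * A) (u * R (suc m) * B - w * R m)
    (oddProd-nonZeroDivisor (Φ (2 ℕ.* c)) isCyclotomic c 1≤c M (λ k → roundHalf m (k ℕ.* c)) _ difference*E≈0)

open import Data.Nat using (_≤_; _*_; _∸_)

lemma6p2 : (Φ : ℕ → PZ) → IsCyclotomicFamily Φ →
    (c : ℕ) → 1 ≤ c →
    (R : ℕ → PZQ) →
    (∀ j → Eqζ Φ c (Qn j) (ZQ.mul (R j) (oddProd Φ c j (λ k → roundHalf j (k * c))))) →
    ∀ n → 2 ≤ n →
    Eqζ Φ c
      (ZQ.mul (R n) (oddProd Φ c n (λ k → α (k * c) n)))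
      (ZQ.sub
        (ZQ.mul (ZQ.mul (ZQ.add oneQ zetaQ) (R (n ∸ 1))) (oddProd Φ c n (λ k → β (k * c) n)))
        (ZQ.mul (ZQ.mul zetaQ (ZQ.sub oneQ (powQ qQ (n ∸ 1)))) (R (n ∸ 2))))
lemma6p2 Φ isCyclotomic c 1≤c R Qn≈RP (suc (suc m)) (s≤s (s≤s z≤n)) =
  ≈⇒Eqζ Φ c (R-recurrence isCyclotomic 1≤c R Qn≈RP m)
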